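{- Let $n=\prod_{i=1}^k p_i$ be a Carmichael number, with $p_1,\dots,p_k$ distinct odd primes, such that $v_2(\lambda(n))=v_2(p_i-1)$ for all $i=1,\dots,k$. Then the index $i(n)=\frac{n-1}{\lambda(n)}$ and $k$ have the same parity.
   Context: A Carmichael number is a composite integer $n$ with $a^{n-1}\equiv1\pmod n$ for all $a$ coprime to $n$; it is squarefree and odd. $\lambda(n)$ is the Carmichael lambda function (smallest positive $\ell$ with $a^\ell\equiv1\pmod n$ for all $a\in\mathbb{Z}_n^*$), which for squarefree $n$ equals $\mathrm{lcm}(p_1-1,\dots,p_k-1)$ and divides $n-1$ when $n$ is Carmichael. $v_2(m)$ denotes the largest $N$ with $2^N\mid m$. -}

module Defs where

open import Data.Nat.Base using (ℕ; zero; suc; _*_; _^_; _∸_; _<_; ∣_-_∣)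
open import Data.Nat.Divisibility using (_∣_)
open import Data.Nat.Coprimality using (Coprime)
open import Data.Nat.Primality using (Composite)
open import Data.Product using (_×_)
open import Relation.Nullary using (¬_)

_≡_[mod_] : ℕ → ℕ → ℕ → Set
a ≡ b [mod n ] = n ∣ ∣ a - b ∣

UniversalExponent : ℕ → ℕ → Set
UniversalExponent n ℓ = ∀ a → Coprime a n → (a ^ ℓ) ≡ 1 [mod n ]

IsCarmichael : ℕ → Set
IsCarmichael n = Composite n × UniversalExponent n (n ∸ 1)

IsCarmichaelLambda : ℕ → ℕ → Set
IsCarmichaelLambda n ℓ =
  0 < ℓ × UniversalExponent n ℓ × (∀ m → 0 < m → UniversalExponent n m → ℓ ≤ m)
  where open import Data.Nat.Base using (_≤_)

V2 : ℕ → ℕ → Set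
V2 m N = (2 ^ N) ∣ m × ¬ ((2 ^ suc N) ∣ m)

-- Let 2^N be the common 2-part of λ(n) and of every p − 1; N ≥ 1 as the primes are odd.
-- Writing p = 1 + aₚ·2^N with aₚ odd, expanding the product gives n = 1 + s·2^N with
-- s ≡ k (mod 2), because all cross terms are even multiples of 2^N. With λ(n) = b·2^N,
-- b odd, the equation n − 1 = i·λ(n) becomes s = i·b, so i ≡ s ≡ k (mod 2).
module Submission where

open import Defs
open import Data.Nat.Base using (ℕ; _∸_; _*_; _%_)
open import Data.Nat.ListAction using (product)
open import Data.Nat.Primality using (Prime)
open import Data.List.Base using (List; length)
open import Data.List.Relation.Unary.All using (All)
open import Data.List.Relation.Unary.Unique.Propositional using (Unique)
open import Data.List.Membership.Propositional using (_∈_)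
open import Data.Product using (∃-syntax; _×_)
open import Relation.Binary.PropositionalEquality using (_≡_)

open import Data.Nat.Base using (zero; suc; _+_; _^_; _≤_; s≤s)
open import Data.Nat.Properties
  using (*-identityʳ; ≤-antisym; ≮⇒≥; m+[n∸m]≡n; ^-distribˡ-+-*; *-assoc; *-cancelʳ-≡; m*n≡0⇒m≡0∨n≡0; m^n≢0)
open import Data.Nat.DivMod using (_/_; m%n<n; m≡m%n+[m/n]*n; %-distribˡ-+; %-distribˡ-*; [m+kn]%n≡m%n; m%n%n≡m%n)
open import Data.Nat.Divisibility using (_∣_; divides; _∣0; ∣-trans; m∣m*n; *-monoˡ-∣; m%n≡0⇒n∣m)
open import Data.Nat.Tactic.RingSolver using (solve-∀)
open import Data.List.Base using ([]; _∷_)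
open import Data.List.Relation.Unary.All as All using ([]; _∷_)
open import Data.List.Relation.Unary.Any using (here)
open import Data.Product using (_,_; proj₁)
open import Data.Sum using (inj₁; inj₂)
open import Data.Empty using (⊥-elim)
open import Function using (case_of_)
open import Relation.Nullary using (¬_)
open import Relation.Binary.PropositionalEquality using (refl; sym; trans; cong; cong₂; subst; module ≡-Reasoning)

^-monoʳ-∣ : ∀ m {i j} → i ≤ j → m ^ i ∣ m ^ j
^-monoʳ-∣ m {i} {j} i≤j =
  subst (λ k → m ^ i ∣ m ^ k) (m+[n∸m]≡n i≤j)
    (subst (m ^ i ∣_) (sym (^-distribˡ-+-* m i (j ∸ i))) (m∣m*n (m ^ (j ∸ i))))

¬2∣⇒odd : ∀ a → ¬ 2 ∣ a → a % 2 ≡ 1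
¬2∣⇒odd a 2∤a with a % 2 | m%n<n a 2 | m%n≡0⇒n∣m a 2
... | 0           | _            | 2∣a = ⊥-elim (2∤a (2∣a refl))
... | 1           | _            | _   = refl
... | suc (suc _) | s≤s (s≤s ()) | _

odd⇒2∣pred : ∀ p → p % 2 ≡ 1 → 2 ∣ p ∸ 1
odd⇒2∣pred p p-odd =
  divides (p / 2) (cong (_∸ 1) (trans (m≡m%n+[m/n]*n p 2) (cong (_+ p / 2 * 2) p-odd)))

*-odd-%2 : ∀ i {b} → b % 2 ≡ 1 → (i * b) % 2 ≡ i % 2
*-odd-%2 i {b} b-odd = begin
  (i * b) % 2             ≡⟨ %-distribˡ-* i b 2 ⟩
  (i % 2 * (b % 2)) % 2   ≡⟨ cong (λ x → (i % 2 * x) % 2) b-odd ⟩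
  (i % 2 * 1) % 2         ≡⟨ cong (_% 2) (*-identityʳ (i % 2)) ⟩
  i % 2 % 2               ≡⟨ m%n%n≡m%n i 2 ⟩
  i % 2                   ∎
  where open ≡-Reasoning

odd+-%2 : ∀ a s L → a % 2 ≡ 1 → s % 2 ≡ L % 2 → (a + s) % 2 ≡ suc L % 2
odd+-%2 a s L a-odd s≡L = begin
  (a + s) % 2             ≡⟨ %-distribˡ-+ a s 2 ⟩
  (a % 2 + s % 2) % 2     ≡⟨ cong₂ (λ x y → (x + y) % 2) a-odd s≡L ⟩
  (1 + L % 2) % 2         ≡⟨ sym (%-distribˡ-+ 1 L 2) ⟩
  suc L % 2               ∎
  where open ≡-Reasoning

V2-maximal : ∀ {m} N M → V2 m N → 2 ^ M ∣ m → M ≤ N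
V2-maximal N M (_ , 2^[1+N]∤m) 2^M∣m =
  ≮⇒≥ (λ N<M → 2^[1+N]∤m (∣-trans (^-monoʳ-∣ 2 N<M) 2^M∣m))

V2-unique : ∀ {m} N N′ → V2 m N → V2 m N′ → N ≡ N′
V2-unique N N′ v v′ = ≤-antisym (V2-maximal N′ N v′ (proj₁ v)) (V2-maximal N N′ v (proj₁ v′))

V2⇒odd* : ∀ {m} N → V2 m N → ∃[ a ] (m ≡ a * 2 ^ N × a % 2 ≡ 1)
V2⇒odd* N (divides a m≡a*2^N , 2^[1+N]∤m) =
  a , m≡a*2^N , ¬2∣⇒odd a (λ 2∣a → 2^[1+N]∤m (subst (2 ^ suc N ∣_) (sym m≡a*2^N) (*-monoˡ-∣ (2 ^ N) 2∣a)))

odd⇒¬V2-pred-0 : ∀ p → p % 2 ≡ 1 → ¬ V2 (p ∸ 1) 0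
odd⇒¬V2-pred-0 p p-odd (_ , 2∤p∸1) = 2∤p∸1 (odd⇒2∣pred p p-odd)

_≡1+odd*_ : ℕ → ℕ → Set
p ≡1+odd* Q = ∃[ a ] (p ≡ 1 + a * Q × a % 2 ≡ 1)

V2-pred⇒≡1+odd*2^ : ∀ {p} N → V2 (p ∸ 1) N → p ≡1+odd* (2 ^ N)
V2-pred⇒≡1+odd*2^ {zero}  N (_ , 2^[1+N]∤0) = ⊥-elim (2^[1+N]∤0 (_ ∣0))
V2-pred⇒≡1+odd*2^ {suc p} N v with V2⇒odd* N v
... | a , p≡a*2^N , a-odd = a , cong suc p≡a*2^N , a-odd

product-≡1+*-parity : ∀ R ps → All (_≡1+odd* (2 * R)) ps →
  ∃[ s ] (product ps ≡ 1 + s * (2 * R) × s % 2 ≡ length ps % 2)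
product-≡1+*-parity R []       []                       = 0 , refl , refl
product-≡1+*-parity R (p ∷ ps) ((a , p≡ , a-odd) ∷ ps≡)
  with product-≡1+*-parity R ps ps≡
... | s , Πps≡ , s≡len =
  a + s + a * s * R * 2 ,
  trans (cong₂ _*_ p≡ Πps≡) (expand a s R) ,
  trans ([m+kn]%n≡m%n (a + s) (a * s * R) 2) (odd+-%2 a s (length ps) a-odd s≡len)
  where
  expand : ∀ a s R → (1 + a * (2 * R)) * (1 + s * (2 * R)) ≡ 1 + (a + s + a * s * R * 2) * (2 * R)
  expand = solve-∀

same-V2⇒≡1+odd*2^ : ∀ {ℓ ps} N → V2 ℓ N →
  (∀ {p} → p ∈ ps → ∃[ N′ ] (V2 ℓ N′ × V2 (p ∸ 1) N′)) → All (_≡1+odd* (2 ^ N)) ps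
same-V2⇒≡1+odd*2^ N v₂ℓ v₂-equal = All.tabulate λ p∈ps → case v₂-equal p∈ps of λ where
  (N′ , v₂ℓ′ , v₂p) → V2-pred⇒≡1+odd*2^ N (subst (V2 _) (V2-unique N′ N v₂ℓ′ v₂ℓ) v₂p)

index-parity : ∀ K ℓ i ps → V2 ℓ (suc K) → All (_≡1+odd* (2 ^ suc K)) ps →
  product ps ∸ 1 ≡ i * ℓ → i % 2 ≡ length ps % 2
index-parity K ℓ i ps v₂ℓ ps≡ Πps∸1≡iℓ
  with V2⇒odd* (suc K) v₂ℓ | product-≡1+*-parity (2 ^ K) ps ps≡
... | b , ℓ≡b*Q , b-odd | s , Πps≡1+s*Q , s≡len = begin
  i % 2         ≡⟨ sym (*-odd-%2 i b-odd) ⟩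
  (i * b) % 2   ≡⟨ cong (_% 2) (sym s≡i*b) ⟩
  s % 2         ≡⟨ s≡len ⟩
  length ps % 2 ∎
  where
  open ≡-Reasoning
  Q = 2 ^ suc K
  instance _ = m^n≢0 2 (suc K)

  s≡i*b : s ≡ i * b
  s≡i*b = *-cancelʳ-≡ s (i * b) Q (begin
    s * Q           ≡⟨ cong (_∸ 1) (sym Πps≡1+s*Q) ⟩
    product ps ∸ 1  ≡⟨ Πps∸1≡iℓ ⟩
    i * ℓ           ≡⟨ cong (i *_) ℓ≡b*Q ⟩
    i * (b * Q)     ≡⟨ sym (*-assoc i b Q) ⟩
    i * b * Q       ∎)

mainTheorem2 : (n : ℕ) (ps : List ℕ) →
    All Prime ps → All (λ p → p % 2 ≡ 1) ps → Unique ps →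
    n ≡ product ps →
    IsCarmichael n →
    (ℓ : ℕ) → IsCarmichaelLambda n ℓ →
    (∀ {p} → p ∈ ps → ∃[ N ] (V2 ℓ N × V2 (p ∸ 1) N)) →
    (i : ℕ) → n ∸ 1 ≡ i * ℓ →
    i % 2 ≡ length ps % 2
mainTheorem2 n [] _ _ _ refl _ ℓ (0<ℓ , _) _ i 0≡iℓ with m*n≡0⇒m≡0∨n≡0 i (sym 0≡iℓ)
... | inj₁ refl = refl
... | inj₂ refl with 0<ℓ
... | ()
mainTheorem2 n ps@(p₀ ∷ _) _ (p₀-odd ∷ _) _ refl _ ℓ _ v₂-equal i n∸1≡iℓ
  with v₂-equal (here refl)
... | zero  , _   , v₂p₀ = ⊥-elim (odd⇒¬V2-pred-0 p₀ p₀-odd v₂p₀)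
... | suc K , v₂ℓ , _    =
  index-parity K ℓ i ps v₂ℓ (same-V2⇒≡1+odd*2^ (suc K) v₂ℓ v₂-equal) n∸1≡iℓ
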